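{- Fix a natural number $m$. The logic $LTL_{Past,m}$ is decidable with respect to admissible rules: there is an algorithm which, for any given inference rule, verifies whether it is admissible in $LTL_{Past,m}$.
   Context: Formulas are built from propositional letters by Boolean connectives, the unary operation $\mathbf{N}$ (next) and the binary operation $\mathbf{S}$ (since). Fix a natural number $m$. A frame is $\langle \mathbb{N},\geq,\mathrm{Next},\bigcup_{i\in\mathbb{N}}R_i\rangle$ where $R_i$ is the order $\geq$ restricted to the interval $[i,i+m]$ (so $b\,R_a\,a$ iff $a\le b\le a+m$). A model is such a frame with a valuation $V$ assigning to each letter a subset of $\mathbb{N}$. Truth: letters via $V$; Boolean connectives as usual; $(\mathcal{M},a)\models\mathbf{N}\varphi$ iff $(\mathcal{M},a+1)\models\varphi$; $(\mathcal{M},a)\models\varphi\,\mathbf{S}\,\psi$ iff there is $b$ with $b\,R_a\,a$, $(\mathcal{M},b)\models\psi$ and $(\mathcal{M},c)\models\varphi$ for all $c$ with $a\le c<b$. $LTL_{Past,m}$ is the set of formulas true at all states of all such models. An inference rule $\varphi_1(x_1,\dots,x_n),\dots,\varphi_l(x_1,\dots,x_n)/\psi(x_1,\dots,x_n)$ is admissible in a logic $L$ if for every tuple of formulas $\alpha_1,\dots,\alpha_n$: if $\varphi_i(\alpha_1,\dots,\alpha_n)\in L$ for all $i$, then $\psi(\alpha_1,\dots,\alpha_n)\in L$. -}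

module Defs where

open import Data.Nat using (ℕ; _+_; _≤_; _<_)
open import Data.Bool using (Bool; T)
open import Data.Unit using (⊤)
open import Data.Empty using (⊥)
open import Data.Product using (Σ; _×_)
open import Data.Sum using (_⊎_)
open import Data.List using (List)
open import Data.List.Relation.Unary.All using (All)
open import Relation.Nullary using (¬_)

data Fm : Set where
  var  : ℕ → Fm
  ⊤'   : Fm
  ⊥'   : Fm
  ¬'_  : Fm → Fm
  _∧'_ : Fm → Fm → Fm
  _∨'_ : Fm → Fm → Fm
  _⇒'_ : Fm → Fm → Fm
  𝐍    : Fm → Fm
  _𝐒_  : Fm → Fm → Fm

-- A valuation assigns to each letter a subset of ℕ (characteristic function).
Valuation : Set
Valuation = ℕ → ℕ → Bool

R : ℕ → ℕ → ℕ → Set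
R m a b = a ≤ b × b ≤ a + m

Sat : ℕ → Valuation → ℕ → Fm → Set
Sat m V a (var p)  = T (V p a)
Sat m V a ⊤'       = ⊤
Sat m V a ⊥'       = ⊥
Sat m V a (¬' φ)   = ¬ Sat m V a φ
Sat m V a (φ ∧' ψ) = Sat m V a φ × Sat m V a ψ
Sat m V a (φ ∨' ψ) = Sat m V a φ ⊎ Sat m V a ψ
Sat m V a (φ ⇒' ψ) = Sat m V a φ → Sat m V a ψ
Sat m V a (𝐍 φ)    = Sat m V (a + 1) φ
Sat m V a (φ 𝐒 ψ)  =
  Σ ℕ λ b → R m a b × Sat m V b ψ × (∀ c → a ≤ c → c < b → Sat m V c φ)

InLTL : ℕ → Fm → Set
InLTL m φ = ∀ (V : Valuation) (a : ℕ) → Sat m V a φ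

subst : (ℕ → Fm) → Fm → Fm
subst σ (var p)  = σ p
subst σ ⊤'       = ⊤'
subst σ ⊥'       = ⊥'
subst σ (¬' φ)   = ¬' subst σ φ
subst σ (φ ∧' ψ) = subst σ φ ∧' subst σ ψ
subst σ (φ ∨' ψ) = subst σ φ ∨' subst σ ψ
subst σ (φ ⇒' ψ) = subst σ φ ⇒' subst σ ψ
subst σ (𝐍 φ)    = 𝐍 (subst σ φ)
subst σ (φ 𝐒 ψ)  = subst σ φ 𝐒 subst σ ψ

record Rule : Set where
  constructor _/_
  field
    premises   : List Fm
    conclusion : Fm

Admissible : ℕ → Rule → Set
Admissible m (ps / c) =
  ∀ (σ : ℕ → Fm) → All (λ φ → InLTL m (subst σ φ)) ps → InLTL m (subst σ c)

module Submission where

-- Truth of a formula is computed as a Boolean ('eval', equivalent to 'Sat'); its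
-- value at a state depends only on its letters on a window of 'horizon m φ'
-- states ('eval-local').  For a rule ps / ψ fix bounds n (letters) and D
-- (horizons) of its formulas.  A *small model* is a finite word of rows
-- (valuations of the letters below n) padded on both sides by one constant row;
-- whether some small model of length at most B satisfies the premises
-- everywhere and refutes ψ somewhere is a finite search ('smallRefutation?').
-- The theorem follows from: the rule is not admissible iff such a small
-- refutation exists.
--  (⇐) Under the marker substitution σ, letter p reads the small model at the
--      distance to the next marker of letter 0.  Every window of every induced
--      valuation is then a window of the small model, so the premises are valid
--      under σ, while a single marker reproduces the small model and refutes ψσ
--      ('refutes→¬admissible').
--  (⇒) A failing instance of ψσ yields a counter-model with constant ends
--      ('FromInstance').  While it is longer than B, the pigeonhole principle on
--      its windows gives a block between two equal windows that can be cut out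
--      ('pump'); the result is one of the small models ('shrink', 'short→small').

open import Defs
open import Data.Nat using (ℕ; zero; suc; _+_; _∸_; _≤_; _<_; _⊔_; z≤n; s≤s; _<?_; _≤?_; _≡ᵇ_)
open import Data.Nat.Properties
open import Data.Nat.Induction using (<-wellFounded)
open import Algebra.Properties.CommutativeSemigroup +-commutativeSemigroup using (xy∙z≈xz∙y)
open import Data.Bool using (Bool; true; false; T; not; _∧_; _∨_; if_then_else_)
open import Data.Bool.Properties using (T?; T-∧; T-∨; T-≡; T-not-≡; ∨-identityʳ)
open import Data.Empty using (⊥; ⊥-elim)
open import Data.Unit using (tt)
open import Data.Fin using (Fin; toℕ)
open import Data.Fin.Properties using (pigeonhole; toℕ<n)
open import Data.List using (List; []; _∷_; [_]; _++_; length; replicate; applyUpTo; upTo; cartesianProductWith; lookup)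
open import Data.List.Properties using (length-applyUpTo; length-++; length-replicate)
open import Data.List.Membership.Propositional using (_∈_; lose)
open import Data.List.Membership.Propositional.Properties using (∈-cartesianProductWith⁺; ∈-upTo⁺)
open import Data.List.Relation.Unary.All using (All; []; _∷_; all?)
import Data.List.Relation.Unary.All as All
open import Data.List.Relation.Unary.Any using (Any; here; there; any?; index; satisfied)
open import Data.List.Relation.Unary.Any.Properties using (lookup-index)
open import Data.Product using (Σ; ∃; _×_; _,_; proj₁; proj₂)
open import Data.Product.Function.NonDependent.Propositional using (_×-⇔_)
open import Data.Sum using (_⊎_; inj₁; inj₂)
open import Data.Sum.Function.Propositional using (_⊎-⇔_)
open import Function.Bundles using (_⇔_; mk⇔; Equivalence)
open import Function.Properties.Equivalence using () renaming (trans to _⟨⇔⟩_; sym to ⇔-sym; refl to ⇔-refl)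
open import Function.Related.TypeIsomorphisms using (→-cong-⇔; ¬-cong-⇔)
open import Induction.WellFounded using (Acc; acc)
open import Relation.Nullary using (¬_; Dec; yes; no; contradiction)
open import Relation.Nullary.Decidable using (_×-dec_; ¬?)
open import Relation.Binary.PropositionalEquality
  using (_≡_; refl; sym; trans; cong; cong₂; module ≡-Reasoning) renaming (subst to ≡-subst; subst₂ to ≡-subst₂)

Since : ℕ → (ℕ → Set) → (ℕ → Set) → ℕ → Set
Since k P Q a = Σ ℕ λ b → R k a b × Q b × (∀ c → a ≤ c → c < b → P c)

since? : ℕ → (ℕ → Bool) → (ℕ → Bool) → ℕ → Bool
since? zero    f g a = g a
since? (suc k) f g a = g a ∨ (f a ∧ since? k f g (suc a))

Since-zero : ∀ {P Q a} → Since 0 P Q a ⇔ Q a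
Since-zero {P} {Q} {a} =
  mk⇔ to (λ q → a , (≤-refl , m≤m+n a 0) , q , λ c a≤c c<a → ⊥-elim (<-irrefl refl (≤-<-trans a≤c c<a)))
  where
  to : Since 0 P Q a → Q a
  to (b , (a≤b , b≤a+0) , q , _) with ≤-antisym a≤b (≡-subst (b ≤_) (+-identityʳ a) b≤a+0)
  ... | refl = q

Since-suc : ∀ {k P Q a} → Since (suc k) P Q a ⇔ (Q a ⊎ (P a × Since k P Q (suc a)))
Since-suc {k} {P} {Q} {a} = mk⇔ to from
  where
  to : Since (suc k) P Q a → Q a ⊎ (P a × Since k P Q (suc a))
  to (b , (a≤b , b≤) , q , ps) with m≤n⇒m<n∨m≡n a≤b
  ... | inj₂ refl = inj₁ q
  ... | inj₁ a<b  = inj₂ (ps a ≤-refl a<b , b , (a<b , ≡-subst (b ≤_) (+-suc a k) b≤) , q , λ c a<c → ps c (<⇒≤ a<c))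
  from : Q a ⊎ (P a × Since k P Q (suc a)) → Since (suc k) P Q a
  from (inj₁ q) = a , (≤-refl , m≤m+n a (suc k)) , q , λ c a≤c c<a → ⊥-elim (<-irrefl refl (≤-<-trans a≤c c<a))
  from (inj₂ (p , b , (a<b , b≤) , q , ps)) = b , (<⇒≤ a<b , ≡-subst (b ≤_) (sym (+-suc a k)) b≤) , q , ps'
    where
    ps' : ∀ c → a ≤ c → c < b → P c
    ps' c a≤c c<b with m≤n⇒m<n∨m≡n a≤c
    ... | inj₁ a<c  = ps c a<c c<b
    ... | inj₂ refl = p

since⇔ : ∀ {P Q : ℕ → Set} {f g : ℕ → Bool} → (∀ b → P b ⇔ T (f b)) → (∀ b → Q b ⇔ T (g b)) →
         ∀ k a → Since k P Q a ⇔ T (since? k f g a)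
since⇔ hP hQ zero    a = Since-zero ⟨⇔⟩ hQ a
since⇔ hP hQ (suc k) a =
  Since-suc ⟨⇔⟩ ((hQ a ⊎-⇔ (hP a ×-⇔ since⇔ hP hQ k (suc a))) ⟨⇔⟩ ⇔-sym (T-∨ ⟨⇔⟩ (⇔-refl ⊎-⇔ T-∧)))

eval : ℕ → Valuation → ℕ → Fm → Bool
eval m V a (var p)  = V p a
eval m V a ⊤'       = true
eval m V a ⊥'       = false
eval m V a (¬' φ)   = not (eval m V a φ)
eval m V a (φ ∧' ψ) = eval m V a φ ∧ eval m V a ψ
eval m V a (φ ∨' ψ) = eval m V a φ ∨ eval m V a ψ
eval m V a (φ ⇒' ψ) = not (eval m V a φ) ∨ eval m V a ψ
eval m V a (𝐍 φ)    = eval m V (a + 1) φ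
eval m V a (φ 𝐒 ψ)  = since? m (λ b → eval m V b φ) (λ b → eval m V b ψ) a

T-not : ∀ {x} → T (not x) ⇔ (¬ T x)
T-not {true}  = mk⇔ (λ ()) (λ f → f tt)
T-not {false} = mk⇔ (λ _ ()) (λ _ → tt)

T-implies : ∀ {x y} → T (not x ∨ y) ⇔ (T x → T y)
T-implies {true}  = mk⇔ (λ t _ → t) (λ f → f tt)
T-implies {false} = mk⇔ (λ _ ()) (λ _ → tt)

Sat⇔eval : ∀ m V φ a → Sat m V a φ ⇔ T (eval m V a φ)
Sat⇔eval m V (var p)  a = ⇔-refl
Sat⇔eval m V ⊤'       a = mk⇔ (λ _ → tt) (λ _ → tt)
Sat⇔eval m V ⊥'       a = mk⇔ (λ ()) (λ ())
Sat⇔eval m V (¬' φ)   a = ¬-cong-⇔ (Sat⇔eval m V φ a) ⟨⇔⟩ ⇔-sym T-not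
Sat⇔eval m V (φ ∧' ψ) a = (Sat⇔eval m V φ a ×-⇔ Sat⇔eval m V ψ a) ⟨⇔⟩ ⇔-sym T-∧
Sat⇔eval m V (φ ∨' ψ) a = (Sat⇔eval m V φ a ⊎-⇔ Sat⇔eval m V ψ a) ⟨⇔⟩ ⇔-sym T-∨
Sat⇔eval m V (φ ⇒' ψ) a = →-cong-⇔ (Sat⇔eval m V φ a) (Sat⇔eval m V ψ a) ⟨⇔⟩ ⇔-sym T-implies
Sat⇔eval m V (𝐍 φ)    a = Sat⇔eval m V φ (a + 1)
Sat⇔eval m V (φ 𝐒 ψ)  a = since⇔ (λ b → Sat⇔eval m V φ b) (λ b → Sat⇔eval m V ψ b) m a

letters : Fm → ℕ
letters (var p)  = suc p
letters ⊤'       = 0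
letters ⊥'       = 0
letters (¬' φ)   = letters φ
letters (φ ∧' ψ) = letters φ ⊔ letters ψ
letters (φ ∨' ψ) = letters φ ⊔ letters ψ
letters (φ ⇒' ψ) = letters φ ⊔ letters ψ
letters (𝐍 φ)    = letters φ
letters (φ 𝐒 ψ)  = letters φ ⊔ letters ψ

-- The truth of φ at a depends only on the states a, …, a + horizon m φ - 1.
horizon : ℕ → Fm → ℕ
horizon m (var p)  = 1
horizon m ⊤'       = 0
horizon m ⊥'       = 0
horizon m (¬' φ)   = horizon m φ
horizon m (φ ∧' ψ) = horizon m φ ⊔ horizon m ψ
horizon m (φ ∨' ψ) = horizon m φ ⊔ horizon m ψ
horizon m (φ ⇒' ψ) = horizon m φ ⊔ horizon m ψ
horizon m (𝐍 φ)    = suc (horizon m φ)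
horizon m (φ 𝐒 ψ)  = m + (horizon m φ ⊔ horizon m ψ)

-- V seen from a and W seen from e agree on the letters below n for d steps.
-- (A record, so that the valuations and origins can be inferred from it.)
record Agree (n d : ℕ) (V : Valuation) (a : ℕ) (W : Valuation) (e : ℕ) : Set where
  constructor agree
  field
    at : ∀ p t → p < n → t < d → V p (a + t) ≡ W p (e + t)
open Agree public

Agree-restrict : ∀ {n d V a W e} n′ s d′ → n′ ≤ n → s + d′ ≤ d →
                 Agree n d V a W e → Agree n′ d′ V (a + s) W (e + s)
Agree-restrict {V = V} {a} {W} {e} n′ s d′ n′≤n s+d′≤d h = agree λ p t p<n′ t<d′ →
  trans (cong (V p) (+-assoc a s t))
        (trans (at h p (s + t) (<-≤-trans p<n′ n′≤n) (<-≤-trans (+-monoʳ-< s t<d′) s+d′≤d))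
               (cong (W p) (sym (+-assoc e s t))))

Agree-weaken : ∀ {n d V a W e} n′ d′ → n′ ≤ n → d′ ≤ d →
               Agree n d V a W e → Agree n′ d′ V a W e
Agree-weaken n′ d′ n′≤n d′≤d h =
  agree λ p t p<n′ t<d′ → at h p t (<-≤-trans p<n′ n′≤n) (<-≤-trans t<d′ d′≤d)

at-origin : ∀ (f g : ℕ → Bool) a e → f (a + 0) ≡ g (e + 0) → f a ≡ g e
at-origin f g a e = ≡-subst₂ (λ x y → f x ≡ g y) (+-identityʳ a) (+-identityʳ e)

since?-cong : ∀ k {f g f′ g′ : ℕ → Bool} a e →
              (∀ i → i < k → f (a + i) ≡ f′ (e + i)) → (∀ i → i ≤ k → g (a + i) ≡ g′ (e + i)) →
              since? k f g a ≡ since? k f′ g′ e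
since?-cong zero {g = g} {g′ = g′} a e hf hg = at-origin g g′ a e (hg 0 z≤n)
since?-cong (suc k) {f} {g} {f′} {g′} a e hf hg =
  cong₂ _∨_ (at-origin g g′ a e (hg 0 z≤n))
            (cong₂ _∧_ (at-origin f f′ a e (hf 0 (s≤s z≤n)))
                       (since?-cong k (suc a) (suc e) (λ i i<k → one-later f f′ (hf (suc i) (s≤s i<k)))
                                                      (λ i i≤k → one-later g g′ (hg (suc i) (s≤s i≤k)))))
  where
  one-later : ∀ {i} (h h′ : ℕ → Bool) → h (a + suc i) ≡ h′ (e + suc i) → h (suc a + i) ≡ h′ (suc e + i)
  one-later {i} h h′ = ≡-subst₂ (λ x y → h x ≡ h′ y) (+-suc a i) (+-suc e i)

Agree-left : ∀ m φ ψ {V a W e} → Agree (letters φ ⊔ letters ψ) (horizon m φ ⊔ horizon m ψ) V a W e →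
             Agree (letters φ) (horizon m φ) V a W e
Agree-left m φ ψ = Agree-weaken (letters φ) (horizon m φ) (m≤m⊔n _ _) (m≤m⊔n _ _)

Agree-right : ∀ m φ ψ {V a W e} → Agree (letters φ ⊔ letters ψ) (horizon m φ ⊔ horizon m ψ) V a W e →
              Agree (letters ψ) (horizon m ψ) V a W e
Agree-right m φ ψ = Agree-weaken (letters ψ) (horizon m ψ) (m≤n⊔m _ _) (m≤n⊔m _ _)

eval-local : ∀ m φ {V W a e} → Agree (letters φ) (horizon m φ) V a W e → eval m V a φ ≡ eval m W e φ
eval-local m (var p)  {V} {W} {a} {e} h = at-origin (V p) (W p) a e (at h p 0 ≤-refl (s≤s z≤n))
eval-local m ⊤'       h = refl
eval-local m ⊥'       h = refl
eval-local m (¬' φ)   h = cong not (eval-local m φ h)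
eval-local m (φ ∧' ψ) h = cong₂ _∧_ (eval-local m φ (Agree-left m φ ψ h)) (eval-local m ψ (Agree-right m φ ψ h))
eval-local m (φ ∨' ψ) h = cong₂ _∨_ (eval-local m φ (Agree-left m φ ψ h)) (eval-local m ψ (Agree-right m φ ψ h))
eval-local m (φ ⇒' ψ) h =
  cong₂ (λ x y → not x ∨ y) (eval-local m φ (Agree-left m φ ψ h)) (eval-local m ψ (Agree-right m φ ψ h))
eval-local m (𝐍 φ)    h = eval-local m φ (Agree-restrict (letters φ) 1 (horizon m φ) ≤-refl ≤-refl h)
eval-local m (φ 𝐒 ψ)  h = since?-cong m _ _
  (λ i i<m → eval-local m φ
     (Agree-restrict (letters φ) i (horizon m φ) (m≤m⊔n _ _) (+-mono-≤ (<⇒≤ i<m) (m≤m⊔n _ _)) h))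
  (λ i i≤m → eval-local m ψ
     (Agree-restrict (letters ψ) i (horizon m ψ) (m≤n⊔m _ _) (+-mono-≤ i≤m (m≤n⊔m _ _)) h))

eval-transfer : ∀ m φ {n d V a W e} → letters φ ≤ n → horizon m φ ≤ d →
                Agree n d V a W e → eval m V a φ ≡ eval m W e φ
eval-transfer m φ lφ≤n hφ≤d h = eval-local m φ (Agree-weaken (letters φ) (horizon m φ) lφ≤n hφ≤d h)

induced : ℕ → (ℕ → Fm) → Valuation → Valuation
induced m σ V p b = eval m V b (σ p)

eval-subst : ∀ m σ φ V a → eval m V a (subst σ φ) ≡ eval m (induced m σ V) a φ
eval-subst m σ (var p)  V a = refl
eval-subst m σ ⊤'       V a = refl
eval-subst m σ ⊥'       V a = refl
eval-subst m σ (¬' φ)   V a = cong not (eval-subst m σ φ V a)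
eval-subst m σ (φ ∧' ψ) V a = cong₂ _∧_ (eval-subst m σ φ V a) (eval-subst m σ ψ V a)
eval-subst m σ (φ ∨' ψ) V a = cong₂ _∨_ (eval-subst m σ φ V a) (eval-subst m σ ψ V a)
eval-subst m σ (φ ⇒' ψ) V a = cong₂ (λ x y → not x ∨ y) (eval-subst m σ φ V a) (eval-subst m σ ψ V a)
eval-subst m σ (𝐍 φ)    V a = eval-subst m σ φ V (a + 1)
eval-subst m σ (φ 𝐒 ψ)  V a =
  since?-cong m a a (λ i _ → eval-subst m σ φ V (a + i)) (λ i _ → eval-subst m σ ψ V (a + i))

Agree-induced : ∀ m σ {n k L d V a W e} →
                (∀ p → p < n → letters (σ p) ≤ k × horizon m (σ p) ≤ L) →
                Agree k (d + L) V a W e → Agree n d (induced m σ V) a (induced m σ W) e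
Agree-induced m σ {L = L} bounds h = agree λ p t p<n t<d →
  eval-transfer m (σ p) (proj₁ (bounds p p<n)) (proj₂ (bounds p p<n))
    (Agree-restrict _ t L ≤-refl (+-monoˡ-≤ L (<⇒≤ t<d)) h)

cut : ℕ → ℕ → Valuation → Valuation
cut i s Y p b with b <? i
... | yes _ = Y p b
... | no  _ = Y p (b + s)

cut-below : ∀ {i s Y p b} → b < i → cut i s Y p b ≡ Y p b
cut-below {i} {b = b} b<i with b <? i
... | yes _   = refl
... | no  b≮i = contradiction b<i b≮i

cut-above : ∀ {i s Y p b} → i ≤ b → cut i s Y p b ≡ Y p (b + s)
cut-above {i} {b = b} i≤b with b <? i
... | yes b<i = contradiction i≤b (<⇒≱ b<i)
... | no  _   = refl

cut-after : ∀ {n d i s Y e} → i ≤ e → Agree n d (cut i s Y) e Y (e + s)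
cut-after {s = s} {Y} {e} i≤e = agree λ p t _ _ →
  trans (cut-above (≤-trans i≤e (m≤m+n e t))) (cong (Y p) (xy∙z≈xz∙y e t s))

cut-before : ∀ {n d i s Y e} → Agree n d Y i Y (i + s) → e < i → Agree n d (cut i s Y) e Y e
cut-before {n} {d} {i} {s} {Y} {e} same e<i = agree agrees
  where
  agrees : ∀ p t → p < n → t < d → cut i s Y p (e + t) ≡ Y p (e + t)
  agrees p t p<n t<d with <-≤-connex (e + t) i
  ... | inj₁ e+t<i = cut-below e+t<i
  ... | inj₂ i≤e+t with m≤n⇒∃[o]m+o≡n i≤e+t
  ... | u , i+u≡e+t = begin
    cut i s Y p (e + t)  ≡⟨ cut-above i≤e+t ⟩
    Y p (e + t + s)      ≡⟨ cong (λ x → Y p (x + s)) (sym i+u≡e+t) ⟩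
    Y p (i + u + s)      ≡⟨ cong (Y p) (xy∙z≈xz∙y i u s) ⟩
    Y p (i + s + u)      ≡⟨ sym (at same p u p<n (<-trans u<t t<d)) ⟩
    Y p (i + u)          ≡⟨ cong (Y p) i+u≡e+t ⟩
    Y p (e + t)          ∎
    where
    open ≡-Reasoning
    u<t : u < t
    u<t = +-cancelˡ-< i u t (≤-trans (≤-reflexive (cong suc i+u≡e+t)) (+-monoˡ-< t e<i))

excerpt : Valuation → ℕ → ℕ → Valuation
excerpt V a s q b with b <? s | b <? s + s
... | yes _ | _     = false
... | no  _ | yes _ = V q (a + (b ∸ s))
... | no  _ | no  _ = false

excerpt-before : ∀ {V a s q b} → b < s → excerpt V a s q b ≡ false
excerpt-before {s = s} {b = b} b<s with b <? s
... | yes _   = refl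
... | no  b≮s = contradiction b<s b≮s

excerpt-after : ∀ {V a s q b} → s + s ≤ b → excerpt V a s q b ≡ false
excerpt-after {s = s} {b = b} 2s≤b with b <? s | b <? s + s
... | yes _ | _        = refl
... | no  _ | yes b<2s = contradiction 2s≤b (<⇒≱ b<2s)
... | no  _ | no  _    = refl

excerpt-copy : ∀ {V a s q t} → t < s → excerpt V a s q (s + t) ≡ V q (a + t)
excerpt-copy {V} {a} {s} {q} {t} t<s with s + t <? s | s + t <? s + s
... | yes s+t<s | _       = contradiction s+t<s (m+n≮m s t)
... | no  _     | yes _   = cong (λ x → V q (a + x)) (m+n∸m≡n s t)
... | no  _     | no  s+t≮2s = contradiction (+-monoʳ-< s t<s) s+t≮2s

module _ {A : Set} where

  nth : A → List A → ℕ → A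
  nth d []       i       = d
  nth d (x ∷ xs) zero    = x
  nth d (x ∷ xs) (suc i) = nth d xs i

  nth-applyUpTo : ∀ d f {k t} → t < k → nth d (applyUpTo f k) t ≡ f t
  nth-applyUpTo d f {suc k} {zero}  _         = refl
  nth-applyUpTo d f {suc k} {suc t} (s≤s t<k) = nth-applyUpTo d (λ i → f (suc i)) t<k

  nth-beyond : ∀ d xs {i} → length xs ≤ i → nth d xs i ≡ d
  nth-beyond d []       _         = refl
  nth-beyond d (x ∷ xs) (s≤s len≤i) = nth-beyond d xs len≤i

  nth-padding : ∀ x k ys {i} → i < k → nth x (replicate k x ++ ys) i ≡ x
  nth-padding x (suc k) ys {zero}  _         = refl
  nth-padding x (suc k) ys {suc i} (s≤s i<k) = nth-padding x k ys i<k

  nth-padded : ∀ x k ys i → nth x (replicate k x ++ ys) (k + i) ≡ nth x ys i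
  nth-padded x zero    ys i = refl
  nth-padded x (suc k) ys i = nth-padded x k ys i

  vectors : List A → ℕ → List (List A)
  vectors xs zero    = [ [] ]
  vectors xs (suc k) = cartesianProductWith _∷_ xs (vectors xs k)

  applyUpTo∈vectors : ∀ xs f k → (∀ t → t < k → f t ∈ xs) → applyUpTo f k ∈ vectors xs k
  applyUpTo∈vectors xs f zero    _ = here refl
  applyUpTo∈vectors xs f (suc k) h = ∈-cartesianProductWith⁺ _∷_ (h 0 (s≤s z≤n))
    (applyUpTo∈vectors xs (λ i → f (suc i)) k (λ t t<k → h (suc t) (s≤s t<k)))

  repetition : ∀ xs (f : ℕ → A) → (∀ i → f i ∈ xs) → ∀ lo →
               Σ ℕ λ i → Σ ℕ λ j → lo ≤ i × i < j × j ≤ lo + length xs × f i ≡ f j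
  repetition xs f f∈xs lo with pigeonhole ≤-refl (λ (k : Fin (suc (length xs))) → index (f∈xs (lo + toℕ k)))
  ... | i , j , i<j , same-index =
    lo + toℕ i , lo + toℕ j , m≤m+n lo (toℕ i) , +-monoʳ-< lo i<j , +-monoʳ-≤ lo (≤-pred (toℕ<n j)) ,
    trans (lookup-index (f∈xs (lo + toℕ i)))
          (trans (cong (lookup xs) same-index) (sym (lookup-index (f∈xs (lo + toℕ j)))))

  maxOver : (A → ℕ) → List A → ℕ
  maxOver f []       = 0
  maxOver f (x ∷ xs) = f x ⊔ maxOver f xs

  ≤-maxOver : ∀ f xs → All (λ x → f x ≤ maxOver f xs) xs
  ≤-maxOver f []       = []
  ≤-maxOver f (x ∷ xs) = m≤m⊔n (f x) _ ∷ All.map (λ le → ≤-trans le (m≤n⊔m (f x) _)) (≤-maxOver f xs)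

next : ℕ → Fm → Fm
next zero    φ = φ
next (suc j) φ = 𝐍 (next j φ)

eval-next : ∀ m V a j φ → eval m V a (next j φ) ≡ eval m V (a + j) φ
eval-next m V a zero    φ = cong (λ x → eval m V x φ) (sym (+-identityʳ a))
eval-next m V a (suc j) φ = trans (eval-next m V (a + 1) j φ) (cong (λ x → eval m V x φ) (+-assoc a 1 j))

ite : Fm → Fm → Fm → Fm
ite θ α β = (θ ∧' α) ∨' ((¬' θ) ∧' β)

eval-ite : ∀ m V a θ α β → eval m V a (ite θ α β) ≡ (if eval m V a θ then eval m V a α else eval m V a β)
eval-ite m V a θ α β with eval m V a θ
... | true  = ∨-identityʳ _
... | false = refl

const : Bool → Fm
const true  = ⊤'
const false = ⊥'

eval-const : ∀ m V a x → eval m V a (const x) ≡ x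
eval-const m V a true  = refl
eval-const m V a false = refl

clear : ℕ → Fm
clear zero    = ⊤'
clear (suc k) = clear k ∧' (¬' next (suc k) (var 0))

clear-sound : ∀ m V x k → T (eval m V x (clear k)) → ∀ i → 0 < i → i ≤ k → ¬ T (V 0 (x + i))
clear-sound m V x zero    h i 0<i i≤0 = contradiction i≤0 (<⇒≱ 0<i)
clear-sound m V x (suc k) h i 0<i i≤1+k with Equivalence.to T-∧ h | m≤n⇒m<n∨m≡n i≤1+k
... | h′ , _ | inj₁ i<1+k = clear-sound m V x k h′ i 0<i (≤-pred i<1+k)
... | _ , ¬next | inj₂ refl = λ v → Equivalence.to T-not ¬next (≡-subst T (sym (eval-next m V x (suc k) (var 0))) v)

clear-complete : ∀ m V x k → (∀ i → 0 < i → i ≤ k → ¬ T (V 0 (x + i))) → T (eval m V x (clear k))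
clear-complete m V x zero    h = tt
clear-complete m V x (suc k) h = Equivalence.from T-∧
  ( clear-complete m V x k (λ i 0<i i≤k → h i 0<i (m≤n⇒m≤1+n i≤k))
  , Equivalence.from T-not (λ v → h (suc k) (s≤s z≤n) ≤-refl (≡-subst T (eval-next m V x (suc k) (var 0)) v)))

module Marking (m span : ℕ) where

  marker : Fm
  marker = var 0 ∧' clear span

  Marked : Valuation → ℕ → Set
  Marked V x = T (eval m V x marker)

  spaced : ∀ {V x i j} → Marked V (x + i) → Marked V (x + j) → i < j → j ≤ i + span → ⊥
  spaced {V} {x} {i} {j} marked-i marked-j i<j j≤i+span =
    clear-sound m V (x + i) span (proj₂ (Equivalence.to T-∧ marked-i))
                (j ∸ i) (m<n⇒0<n∸m i<j) (m≤n+o⇒m∸n≤o j i j≤i+span)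
      (≡-subst (λ b → T (V 0 b)) (sym x+i+[j∸i]≡x+j) (proj₁ (Equivalence.to T-∧ marked-j)))
    where
    x+i+[j∸i]≡x+j : x + i + (j ∸ i) ≡ x + j
    x+i+[j∸i]≡x+j = trans (+-assoc x i (j ∸ i)) (cong (x +_) (m+[n∸m]≡n (<⇒≤ i<j)))

  unmarked : ∀ {V y} → ¬ Marked V y → eval m V y marker ≡ false
  unmarked ¬marked = Equivalence.to T-not-≡ (Equivalence.from T-not ¬marked)

  pick : ℕ → ℕ → (ℕ → Fm) → Fm → Fm
  pick zero    j α δ = δ
  pick (suc r) j α δ = ite (next j marker) (α j) (pick r (suc j) α δ)

  pick-step : ∀ V x r j α δ → eval m V x (pick (suc r) j α δ) ≡
              (if eval m V (x + j) marker then eval m V x (α j) else eval m V x (pick r (suc j) α δ))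
  pick-step V x r j α δ =
    trans (eval-ite m V x (next j marker) (α j) (pick r (suc j) α δ))
          (cong (λ b → if b then eval m V x (α j) else eval m V x (pick r (suc j) α δ)) (eval-next m V x j marker))

  pick-marked : ∀ V x r j α δ → Marked V (x + j) → eval m V x (pick (suc r) j α δ) ≡ eval m V x (α j)
  pick-marked V x r j α δ marked = trans (pick-step V x r j α δ)
    (cong (λ b → if b then eval m V x (α j) else eval m V x (pick r (suc j) α δ)) (Equivalence.to T-≡ marked))

  pick-unmarked : ∀ V x r j α δ → ¬ Marked V (x + j) → eval m V x (pick (suc r) j α δ) ≡ eval m V x (pick r (suc j) α δ)
  pick-unmarked V x r j α δ ¬marked = trans (pick-step V x r j α δ)
    (cong (λ b → if b then eval m V x (α j) else eval m V x (pick r (suc j) α δ)) (unmarked ¬marked))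

  pick-none : ∀ V x r j α δ → (∀ i → j ≤ i → i < j + r → ¬ Marked V (x + i)) →
              eval m V x (pick r j α δ) ≡ eval m V x δ
  pick-none V x zero    j α δ none = refl
  pick-none V x (suc r) j α δ none =
    trans (pick-unmarked V x r j α δ (none j ≤-refl (m<m+n j (s≤s z≤n))))
          (pick-none V x r (suc j) α δ λ i j<i i<1+j+r →
             none i (<⇒≤ j<i) (≤-trans i<1+j+r (≤-reflexive (sym (+-suc j r)))))

  pick-first : ∀ V x r j α δ h → j ≤ h → h < j + r → Marked V (x + h) →
               (∀ i → j ≤ i → i < h → ¬ Marked V (x + i)) → eval m V x (pick r j α δ) ≡ eval m V x (α h)
  pick-first V x zero    j α δ h j≤h h<j+0 _ _ = contradiction j≤h (<⇒≱ (≡-subst (h <_) (+-identityʳ j) h<j+0))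
  pick-first V x (suc r) j α δ h j≤h h<j+1+r marked-h before with m≤n⇒m<n∨m≡n j≤h
  ... | inj₂ refl = pick-marked V x r j α δ marked-h
  ... | inj₁ j<h  = trans (pick-unmarked V x r j α δ (before j ≤-refl j<h))
                          (pick-first V x r (suc j) α δ h j<h (≤-trans h<j+1+r (≤-reflexive (+-suc j r))) marked-h
                                      λ i j<i i<h → before i (<⇒≤ j<i) i<h)

-- The substitution that makes any valuation look, window by window, like Y:
-- letter p becomes "Y p (ℓ - j), where the next marker is j ≤ ℓ states ahead,
-- and Y p ℓ if there is none".
module Readout (m : ℕ) (Y : Valuation) (ℓ D : ℕ) where

  open Marking m (ℓ + D)

  σ : ℕ → Fm
  σ p = pick ℓ 1 (λ j → const (Y p (ℓ ∸ j))) (const (Y p ℓ))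

  read-near : ∀ V x p j → 0 < j → j ≤ ℓ → Marked V (x + j) → induced m σ V p x ≡ Y p (ℓ ∸ j)
  read-near V x p j 0<j j≤ℓ marked-j = trans (pick-first V x ℓ 1 _ _ j 0<j (s≤s j≤ℓ) marked-j before) (eval-const m V x _)
    where
    before : ∀ i → 1 ≤ i → i < j → ¬ Marked V (x + i)
    before i _ i<j marked-i = spaced marked-i marked-j i<j (≤-trans j≤ℓ (≤-trans (m≤m+n ℓ D) (m≤n+m (ℓ + D) i)))

  read-far : ∀ V x p → (∀ i → 0 < i → i ≤ ℓ → ¬ Marked V (x + i)) → induced m σ V p x ≡ Y p ℓ
  read-far V x p none = trans (pick-none V x ℓ 1 _ _ (λ i 1≤i i<1+ℓ → none i 1≤i (≤-pred i<1+ℓ))) (eval-const m V x _)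

  lone : Valuation
  lone q x = x ≡ᵇ ℓ

  lone-marked : Marked lone ℓ
  lone-marked = Equivalence.from T-∧ (≡⇒≡ᵇ ℓ ℓ refl , clear-complete m lone ℓ (ℓ + D) λ i 0<i _ ℓ+i≡ᵇℓ →
    <⇒≢ (m<m+n ℓ 0<i) (sym (≡ᵇ⇒≡ (ℓ + i) ℓ ℓ+i≡ᵇℓ)))

  lone-unmarked : ∀ {x} → ℓ < x → ¬ Marked lone x
  lone-unmarked {x} ℓ<x marked = <⇒≢ ℓ<x (sym (≡ᵇ⇒≡ x ℓ (proj₁ (Equivalence.to T-∧ marked))))

  Quiet : Set
  Quiet = ∀ p b → b < D ⊎ ℓ ≤ b → Y p b ≡ Y p ℓ

  module _ (quiet : Quiet) (0<D : 0 < D) where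

    quiet-both : ∀ {p a b} → a < D ⊎ ℓ ≤ a → b < D ⊎ ℓ ≤ b → Y p a ≡ Y p b
    quiet-both {p} {a} {b} qa qb = trans (quiet p a qa) (sym (quiet p b qb))

    -- Past ℓ, the marker j states ahead reads Y at 0 = ℓ - j, which is also quiet.
    read-marked : ∀ V x p j → 0 < j → j ≤ ℓ + D → Marked V (x + j) → induced m σ V p x ≡ Y p (ℓ ∸ j)
    read-marked V x p j 0<j j≤span marked-j with j ≤? ℓ
    ... | yes j≤ℓ = read-near V x p j 0<j j≤ℓ marked-j
    ... | no  j≰ℓ = trans (read-far V x p none)
                          (quiet-both (inj₂ ≤-refl) (inj₁ (≤-trans (s≤s (≤-reflexive (m≤n⇒m∸n≡0 (<⇒≤ (≰⇒> j≰ℓ))))) 0<D)))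
      where
      none : ∀ i → 0 < i → i ≤ ℓ → ¬ Marked V (x + i)
      none i _ i≤ℓ marked-i = spaced marked-i marked-j (≤-<-trans i≤ℓ (≰⇒> j≰ℓ)) (≤-trans j≤span (m≤n+m (ℓ + D) i))

    beyond-ℓ : ∀ {j t} → ℓ < j → t < D → (ℓ ∸ j) + t < D
    beyond-ℓ {j} {t} ℓ<j t<D = ≡-subst (λ z → z + t < D) (sym (m≤n⇒m∸n≡0 (<⇒≤ ℓ<j))) t<D

    shifted-before : ∀ {p j t} → t < j → t < D → Y p (ℓ ∸ (j ∸ t)) ≡ Y p ((ℓ ∸ j) + t)
    shifted-before {p} {j} {t} t<j t<D with j ≤? ℓ
    ... | yes j≤ℓ = cong (Y p) (begin
      ℓ ∸ (j ∸ t)                         ≡⟨ cong (_∸ (j ∸ t)) ℓ≡ ⟩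
      ((ℓ ∸ j) + t) + (j ∸ t) ∸ (j ∸ t)   ≡⟨ m+n∸n≡m ((ℓ ∸ j) + t) (j ∸ t) ⟩
      (ℓ ∸ j) + t                         ∎)
      where
      open ≡-Reasoning
      ℓ≡ : ℓ ≡ (ℓ ∸ j) + t + (j ∸ t)
      ℓ≡ = trans (sym (m∸n+n≡m j≤ℓ))
             (trans (cong ((ℓ ∸ j) +_) (sym (m+[n∸m]≡n (<⇒≤ t<j)))) (sym (+-assoc (ℓ ∸ j) t (j ∸ t))))
    ... | no  j≰ℓ = quiet-both (inj₁ (≤-<-trans ℓ∸[j∸t]≤t t<D)) (inj₁ (beyond-ℓ (≰⇒> j≰ℓ) t<D))
      where
      ℓ∸[j∸t]≤t : ℓ ∸ (j ∸ t) ≤ t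
      ℓ∸[j∸t]≤t = m≤n+o⇒m∸n≤o ℓ (j ∸ t) (≤-trans (<⇒≤ (≰⇒> j≰ℓ)) (≤-reflexive (sym (m∸n+n≡m (<⇒≤ t<j)))))

    shifted-after : ∀ {p j t} → j ≤ t → t < D → Y p ℓ ≡ Y p ((ℓ ∸ j) + t)
    shifted-after {p} {j} {t} j≤t t<D with j ≤? ℓ
    ... | yes j≤ℓ = sym (quiet p _ (inj₂ (≤-trans (≤-reflexive (sym (m∸n+n≡m j≤ℓ))) (+-monoʳ-≤ (ℓ ∸ j) j≤t))))
    ... | no  j≰ℓ = sym (quiet p _ (inj₁ (beyond-ℓ (≰⇒> j≰ℓ) t<D)))

    -- Every window of length D of the induced valuation is a window of Y
    -- starting at some e ≤ ℓ: at most one marker lies in [x, x + ℓ + D].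
    induced-window : ∀ k V x → Σ ℕ λ e → e ≤ ℓ × Agree k D (induced m σ V) x Y e
    induced-window k V x with anyUpTo? (λ j → T? (eval m V (x + j) marker)) (suc (ℓ + D))
    ... | yes (j , j<1+span , marked-j) = ℓ ∸ j , m∸n≤m ℓ j , agree reading
      where
      reading : ∀ p t → p < k → t < D → induced m σ V p (x + t) ≡ Y p ((ℓ ∸ j) + t)
      reading p t _ t<D with <-≤-connex t j
      ... | inj₁ t<j = trans (read-marked V (x + t) p (j ∸ t) (m<n⇒0<n∸m t<j) (≤-trans (m∸n≤m j t) (≤-pred j<1+span))
                                (≡-subst (Marked V) (sym x+t+[j∸t]≡x+j) marked-j))
                             (shifted-before t<j t<D)
        where
        x+t+[j∸t]≡x+j : x + t + (j ∸ t) ≡ x + j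
        x+t+[j∸t]≡x+j = trans (+-assoc x t (j ∸ t)) (cong (x +_) (m+[n∸m]≡n (<⇒≤ t<j)))
      ... | inj₂ j≤t = trans (read-far V (x + t) p none) (shifted-after j≤t t<D)
        where
        none : ∀ i → 0 < i → i ≤ ℓ → ¬ Marked V (x + t + i)
        none i 0<i i≤ℓ marked-i = spaced marked-j (≡-subst (Marked V) (+-assoc x t i) marked-i)
          (≤-<-trans j≤t (m<m+n t 0<i))
          (≤-trans (+-mono-≤ (<⇒≤ t<D) i≤ℓ) (≤-trans (≤-reflexive (+-comm D ℓ)) (m≤n+m (ℓ + D) j)))
    ... | no none-ahead = ℓ , ≤-refl , agree λ p t _ t<D →
      trans (read-far V (x + t) p (λ i 0<i i≤ℓ marked-i →
               none-ahead (t + i , s≤s (≤-trans (+-mono-≤ (<⇒≤ t<D) i≤ℓ) (≤-reflexive (+-comm D ℓ))) ,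
                           ≡-subst (Marked V) (+-assoc x t i) marked-i)))
            (sym (quiet p (ℓ + t) (inj₂ (m≤m+n ℓ t))))

    lone-reads-Y : ∀ p x → induced m σ lone p x ≡ Y p x
    lone-reads-Y p x with <-≤-connex x ℓ
    ... | inj₁ x<ℓ = trans (read-near lone x p (ℓ ∸ x) (m<n⇒0<n∸m x<ℓ) (m∸n≤m ℓ x)
                              (≡-subst (Marked lone) (sym (m+[n∸m]≡n (<⇒≤ x<ℓ))) lone-marked))
                           (cong (Y p) (m∸[m∸n]≡n (<⇒≤ x<ℓ)))
    ... | inj₂ ℓ≤x = trans (read-far lone x p (λ i 0<i _ → lone-unmarked (≤-<-trans ℓ≤x (m<m+n x 0<i))))
                           (sym (quiet p x (inj₂ ℓ≤x)))

module Decision (m : ℕ) (ps : List Fm) (ψ : Fm) where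

  -- Bounds for all formulas of the rule: letters below n, horizons below D.
  -- (D ≥ 1, so that windows are never empty.)
  n : ℕ
  n = maxOver letters (ψ ∷ ps)

  D : ℕ
  D = suc (maxOver (horizon m) (ψ ∷ ps))

  Bounded : Fm → Set
  Bounded φ = letters φ ≤ n × horizon m φ ≤ D

  bounded : All Bounded (ψ ∷ ps)
  bounded = All.zip (≤-maxOver letters (ψ ∷ ps) , All.map m≤n⇒m≤1+n (≤-maxOver (horizon m) (ψ ∷ ps)))

  Premises : Valuation → ℕ → Set
  Premises Y e = All (λ φ → T (eval m Y e φ)) ps

  premises-transfer : ∀ {V a W e} → Agree n D V a W e → Premises W e → Premises V a
  premises-transfer h prem =
    All.zipWith (λ { {φ} ((l , d) , t) → ≡-subst T (sym (eval-transfer m φ l d h)) t }) (All.tail bounded , prem)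

  conclusion-transfer : ∀ {V a W e} → Agree n D V a W e → eval m V a ψ ≡ eval m W e ψ
  conclusion-transfer = eval-transfer m ψ (proj₁ (All.head bounded)) (proj₂ (All.head bounded))

  row : Valuation → ℕ → List Bool
  row Y b = applyUpTo (λ p → Y p b) n

  letter : List Bool → ℕ → Bool
  letter c p = nth false c p

  letter-row : ∀ Y b {p} → p < n → letter (row Y b) p ≡ Y p b
  letter-row Y b = nth-applyUpTo false (λ p → Y p b)

  Rows : List (List Bool)
  Rows = vectors (true ∷ false ∷ []) n

  row∈Rows : ∀ Y b → row Y b ∈ Rows
  row∈Rows Y b = applyUpTo∈vectors _ _ n (λ p _ → bool∈ (Y p b))
    where
    bool∈ : ∀ x → x ∈ true ∷ false ∷ []
    bool∈ true  = here refl
    bool∈ false = there (here refl)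

  small : List Bool → List (List Bool) → Valuation
  small c z p b = letter (nth c (replicate D c ++ z) b) p

  -- The small model refutes the rule: the premises hold at every state up to
  -- D + length z (from there on nothing changes), the conclusion fails somewhere.
  Refutes : List Bool → List (List Bool) → Set
  Refutes c z = (∀ {e} → e < suc (D + length z) → Premises (small c z) e)
              × ∃ λ b → b < suc (D + length z) × ¬ T (eval m (small c z) b ψ)

  refutes? : ∀ c z → Dec (Refutes c z)
  refutes? c z =
    allUpTo? (λ e → all? (λ φ → T? (eval m (small c z) e φ)) ps) (suc (D + length z))
    ×-dec anyUpTo? (λ b → ¬? (T? (eval m (small c z) b ψ))) (suc (D + length z))

  -- All windows of D rows; every counter-model can be shrunk below B (see pump).
  Windows : List (List (List Bool))
  Windows = vectors Rows D

  B : ℕ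
  B = D + length Windows + length Windows

  SmallRefutation : Set
  SmallRefutation = ∃ λ k → k < suc B × Any (λ c → Any (Refutes c) (vectors Rows k)) Rows

  smallRefutation? : Dec SmallRefutation
  smallRefutation? = anyUpTo? (λ k → any? (λ c → any? (refutes? c) (vectors Rows k)) Rows) (suc B)

  record CounterModel (c : List Bool) : Set where
    field
      Y        : Valuation
      N b₀     : ℕ
      D≤N      : D ≤ N
      b₀≤N     : b₀ ≤ N
      start    : ∀ p b → p < n → b < D → Y p b ≡ letter c p
      end      : ∀ p b → p < n → N ≤ b → Y p b ≡ letter c p
      premises : ∀ e → Premises Y e
      refuted  : ¬ T (eval m Y b₀ ψ)

  short→small : ∀ {c} → c ∈ Rows → (M : CounterModel c) → CounterModel.N M ≤ B → SmallRefutation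
  short→small {c} c∈Rows M N≤B =
    k , s≤s (≤-trans (m∸n≤m N D) N≤B) ,
    lose c∈Rows (lose (applyUpTo∈vectors Rows _ k (λ i _ → row∈Rows Y (D + i))) refutes)
    where
    open CounterModel M
    k : ℕ
    k = N ∸ D
    z : List (List Bool)
    z = applyUpTo (λ i → row Y (D + i)) k

    length-small : D + length z ≡ N
    length-small = trans (cong (D +_) (length-applyUpTo _ k)) (m+[n∸m]≡n D≤N)

    small≡Y : ∀ p b → p < n → small c z p b ≡ Y p b
    small≡Y p b p<n with b <? D
    ... | yes b<D = trans (cong (λ r → letter r p) (nth-padding c D z b<D)) (sym (start p b p<n b<D))
    ... | no b≮D with m≤n⇒∃[o]m+o≡n (≮⇒≥ b≮D)
    ... | i , refl with i <? k
    ...   | yes i<k = trans (cong (λ r → letter r p) (trans (nth-padded c D z i) (nth-applyUpTo c _ i<k)))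
                            (letter-row Y (D + i) p<n)
    ...   | no i≮k  = trans (cong (λ r → letter r p) (trans (nth-padded c D z i) (nth-beyond c z length-z≤i)))
                            (sym (end p (D + i) p<n N≤D+i))
      where
      length-z≤i : length z ≤ i
      length-z≤i = ≤-trans (≤-reflexive (length-applyUpTo _ k)) (≮⇒≥ i≮k)
      N≤D+i : N ≤ D + i
      N≤D+i = ≤-trans (≤-reflexive (sym (m+[n∸m]≡n D≤N))) (+-monoʳ-≤ D (≮⇒≥ i≮k))

    agrees : ∀ e → Agree n D (small c z) e Y e
    agrees e = agree λ p t p<n _ → small≡Y p (e + t) p<n

    refutes : Refutes c z
    refutes = (λ {e} _ → premises-transfer (agrees e) (premises e))
            , b₀ , s≤s (≤-trans b₀≤N (≤-reflexive (sym length-small)))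
            , λ t → refuted (≡-subst T (conclusion-transfer (agrees b₀)) t)

  remove : ∀ {c} (M : CounterModel c) i j → let open CounterModel M in
           D ≤ i → i < j → j ≤ N → Agree n D Y i Y j → b₀ < i ⊎ j ≤ b₀ →
           Σ (CounterModel c) λ M′ → CounterModel.N M′ < N
  remove {c} M i j D≤i i<j j≤N same position = M′ , ∸-monoʳ-< (m<n⇒0<n∸m i<j) s≤N
    where
    open CounterModel M
    s : ℕ
    s = j ∸ i
    i+s≡j : i + s ≡ j
    i+s≡j = m+[n∸m]≡n (<⇒≤ i<j)
    s≤N : s ≤ N
    s≤N = ≤-trans (m∸n≤m j i) j≤N
    i≤N∸s : i ≤ N ∸ s
    i≤N∸s = m+n≤o⇒m≤o∸n i (≤-trans (≤-reflexive i+s≡j) j≤N)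
    Y′ : Valuation
    Y′ = cut i s Y
    same′ : Agree n D Y i Y (i + s)
    same′ = ≡-subst (Agree n D Y i Y) (sym i+s≡j) same

    window′ : ∀ e → Σ ℕ λ e′ → Agree n D Y′ e Y e′
    window′ e with <-≤-connex e i
    ... | inj₁ e<i = e , cut-before same′ e<i
    ... | inj₂ i≤e = e + s , cut-after i≤e

    refuting : b₀ < i ⊎ j ≤ b₀ → Σ ℕ λ b → b ≤ N ∸ s × Agree n D Y′ b Y b₀
    refuting (inj₁ b₀<i) = b₀ , ≤-trans (<⇒≤ b₀<i) i≤N∸s , cut-before same′ b₀<i
    refuting (inj₂ j≤b₀) = b₀ ∸ s , ∸-monoˡ-≤ s b₀≤N ,
                           ≡-subst (Agree n D Y′ (b₀ ∸ s) Y) (m∸n+n≡m s≤b₀)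
                                   (cut-after (m+n≤o⇒m≤o∸n i (≤-trans (≤-reflexive i+s≡j) j≤b₀)))
      where
      s≤b₀ : s ≤ b₀
      s≤b₀ = ≤-trans (m∸n≤m j i) j≤b₀

    M′ : CounterModel c
    M′ = record
      { Y        = Y′
      ; N        = N ∸ s
      ; b₀       = proj₁ (refuting position)
      ; D≤N      = ≤-trans D≤i i≤N∸s
      ; b₀≤N     = proj₁ (proj₂ (refuting position))
      ; start    = λ p b p<n b<D → trans (cut-below (<-≤-trans b<D D≤i)) (start p b p<n b<D)
      ; end      = λ p b p<n N∸s≤b → trans (cut-above (≤-trans i≤N∸s N∸s≤b))
                     (end p (b + s) p<n (≤-trans (≤-reflexive (sym (m∸n+n≡m s≤N))) (+-monoˡ-≤ s N∸s≤b)))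
      ; premises = λ e → premises-transfer (proj₂ (window′ e)) (premises (proj₁ (window′ e)))
      ; refuted  = λ t → refuted (≡-subst T (conclusion-transfer (proj₂ (proj₂ (refuting position)))) t)
      }

  window : Valuation → ℕ → List (List Bool)
  window Y b = applyUpTo (λ t → row Y (b + t)) D

  window∈Windows : ∀ Y b → window Y b ∈ Windows
  window∈Windows Y b = applyUpTo∈vectors Rows _ D (λ t _ → row∈Rows Y (b + t))

  window-agree : ∀ {Y i j} → window Y i ≡ window Y j → Agree n D Y i Y j
  window-agree {Y} {i} {j} eq = agree λ p t p<n t<D →
    trans (sym (read i p<n t<D)) (trans (cong (λ w → letter (nth [] w t) p) eq) (read j p<n t<D))
    where
    read : ∀ b {p t} → p < n → t < D → letter (nth [] (window Y b) t) p ≡ Y p (b + t)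
    read b {p} p<n t<D = trans (cong (λ r → letter r p) (nth-applyUpTo [] (λ t → row Y (b + t)) t<D)) (letter-row Y _ p<n)

  repeated-window : ∀ Y lo → Σ ℕ λ i → Σ ℕ λ j → lo ≤ i × i < j × j ≤ lo + length Windows × Agree n D Y i Y j
  repeated-window Y lo =
    let (i , j , lo≤i , i<j , j≤ , eq) = repetition Windows (window Y) (window∈Windows Y) lo
    in i , j , lo≤i , i<j , j≤ , window-agree eq

  -- A counter-model longer than B has a removable block: among any
  -- length Windows + 1 consecutive windows two coincide (pigeonhole); such a
  -- pair is found before the refuting state if it lies beyond D + length Windows,
  -- and right after D + length Windows otherwise.
  pump : ∀ {c} (M : CounterModel c) → B < CounterModel.N M →
         Σ (CounterModel c) λ M′ → CounterModel.N M′ < CounterModel.N M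
  pump M B<N with D + length Windows ≤? CounterModel.b₀ M
  ... | yes D+K≤b₀ with repeated-window (CounterModel.Y M) D
  ...   | i , j , D≤i , i<j , j≤D+K , same =
    remove M i j D≤i i<j (≤-trans j≤b₀ (CounterModel.b₀≤N M)) same (inj₂ j≤b₀)
    where
    j≤b₀ : j ≤ CounterModel.b₀ M
    j≤b₀ = ≤-trans j≤D+K D+K≤b₀
  pump M B<N | no D+K≰b₀ with repeated-window (CounterModel.Y M) (D + length Windows)
  ...   | i , j , D+K≤i , i<j , j≤B , same =
    remove M i j (≤-trans (m≤m+n D _) D+K≤i) i<j (≤-trans j≤B (<⇒≤ B<N)) same (inj₁ (<-≤-trans (≰⇒> D+K≰b₀) D+K≤i))

  shrink : ∀ {c} (M : CounterModel c) → Acc _<_ (CounterModel.N M) →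
           Σ (CounterModel c) λ M′ → CounterModel.N M′ ≤ B
  shrink M (acc smaller) with CounterModel.N M ≤? B
  ... | yes N≤B = M , N≤B
  ... | no  N≰B = let (M′ , N′<N) = pump M (≰⇒> N≰B) in shrink M′ (smaller N′<N)

  -- A failing substitution instance yields a counter-model: copy a long enough
  -- window around the failure into an otherwise empty valuation V₀; the valuation
  -- induced by σ on V₀ is constant where V₀ is empty, satisfies the premises
  -- (they are valid under σ) and refutes the conclusion.
  module FromInstance (σ : ℕ → Fm) (valid : All (λ φ → InLTL m (subst σ φ)) ps)
                      (V : Valuation) (a : ℕ) (fails : ¬ T (eval m V a (subst σ ψ))) where

    k L s : ℕ
    k = maxOver (λ p → letters (σ p)) (upTo n)
    L = maxOver (λ p → horizon m (σ p)) (upTo n)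
    s = D + L

    σ-bounded : ∀ p → p < n → letters (σ p) ≤ k × horizon m (σ p) ≤ L
    σ-bounded p p<n = All.lookup (≤-maxOver _ (upTo n)) (∈-upTo⁺ p<n) , All.lookup (≤-maxOver _ (upTo n)) (∈-upTo⁺ p<n)

    V₀ : Valuation
    V₀ = excerpt V a s

    empty : Valuation
    empty _ _ = false

    c : List Bool
    c = row (induced m σ empty) 0

    c∈Rows : c ∈ Rows
    c∈Rows = row∈Rows (induced m σ empty) 0

    quiet : ∀ b → (∀ q t → t < suc L → V₀ q (b + t) ≡ false) → ∀ p → p < n → induced m σ V₀ p b ≡ letter c p
    quiet b isEmpty p p<n =
      trans (at-origin (induced m σ V₀ p) (induced m σ empty p) b 0
               (at (Agree-induced m σ {d = 1} σ-bounded (agree λ q t _ t<1+L → isEmpty q t t<1+L)) p 0 p<n (s≤s z≤n)))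
            (sym (letter-row (induced m σ empty) 0 p<n))

    counterModel : CounterModel c
    counterModel = record
      { Y        = induced m σ V₀
      ; N        = s + s
      ; b₀       = s
      ; D≤N      = ≤-trans (m≤m+n D L) (m≤m+n s s)
      ; b₀≤N     = m≤m+n s s
      ; start    = λ p b p<n b<D → quiet b (λ q t t<1+L → excerpt-before {V} {a} {s} (+-mono-<-≤ b<D (≤-pred t<1+L))) p p<n
      ; end      = λ p b p<n 2s≤b → quiet b (λ q t _ → excerpt-after {V} {a} {s} (≤-trans 2s≤b (m≤m+n b t))) p p<n
      ; premises = premises-V₀
      ; refuted  = λ t → fails (≡-subst T (sym (trans (eval-subst m σ ψ V a) (sym (conclusion-transfer copy)))) t)
      }
      where
      premises-V₀ : ∀ e → Premises (induced m σ V₀) e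
      premises-V₀ e = All.map (λ {φ} valid-φ → ≡-subst T (eval-subst m σ φ V₀ e)
                                                 (Equivalence.to (Sat⇔eval m V₀ (subst σ φ) e) (valid-φ V₀ e))) valid
      copy : Agree n D (induced m σ V₀) s (induced m σ V) a
      copy = Agree-induced m σ σ-bounded (agree λ q t _ t<s → excerpt-copy {V} {a} {s} t<s)

  -- A small refuting model refutes the rule: under the marker substitution
  -- every premise is valid (each window of any induced valuation is a window of
  -- the small model up to its end), while the lone marker reproduces the model.
  refutes→¬admissible : ∀ c z → Refutes c z → ¬ Admissible m (ps / ψ)
  refutes→¬admissible c z (premises-small , b₀ , _ , refuted) admissible = refuted conclusion-holds
    where
    ℓ : ℕ
    ℓ = D + length z
    open Readout m (small c z) ℓ D

    0<D : 0 < D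
    0<D = s≤s z≤n

    quiet : Quiet
    quiet p b b-outside = cong (λ r → letter r p) (trans (at-c b-outside) (sym (at-c (inj₂ ≤-refl))))
      where
      at-c : ∀ {b} → b < D ⊎ ℓ ≤ b → nth c (replicate D c ++ z) b ≡ c
      at-c (inj₁ b<D) = nth-padding c D z b<D
      at-c (inj₂ ℓ≤b) = nth-beyond c (replicate D c ++ z)
                          (≤-trans (≤-reflexive (trans (length-++ (replicate D c)) (cong (_+ length z) (length-replicate D)))) ℓ≤b)

    valid : All (λ φ → InLTL m (subst σ φ)) ps
    valid = All.tabulate λ {φ} φ∈ps V a →
      let (e , e≤ℓ , same) = induced-window quiet 0<D n V a in
      Equivalence.from (Sat⇔eval m V (subst σ φ) a)
        (≡-subst T (sym (eval-subst m σ φ V a)) (All.lookup (premises-transfer same (premises-small (s≤s e≤ℓ))) φ∈ps))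

    reproduces : Agree n D (induced m σ lone) b₀ (small c z) b₀
    reproduces = agree λ p t _ _ → lone-reads-Y quiet 0<D p (b₀ + t)

    conclusion-holds : T (eval m (small c z) b₀ ψ)
    conclusion-holds = ≡-subst T (conclusion-transfer reproduces)
      (≡-subst T (eval-subst m σ ψ lone b₀)
        (Equivalence.to (Sat⇔eval m lone (subst σ ψ) b₀) (admissible σ valid lone b₀)))

  small→¬admissible : SmallRefutation → ¬ Admissible m (ps / ψ)
  small→¬admissible (_ , _ , found) =
    let (c , found-z) = satisfied found ; (z , refutes) = satisfied found-z in refutes→¬admissible c z refutes

  ¬small→admissible : ¬ SmallRefutation → Admissible m (ps / ψ)
  ¬small→admissible no-small σ valid V a with T? (eval m V a (subst σ ψ))
  ... | yes holds = Equivalence.from (Sat⇔eval m V (subst σ ψ) a) holds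
  ... | no  fails =
    let open FromInstance σ valid V a fails
        (short , N≤B) = shrink counterModel (<-wellFounded _)
    in contradiction (short→small c∈Rows short N≤B) no-small

theorem3 : (m : ℕ) → (r : Rule) → Dec (Admissible m r)
theorem3 m (ps / ψ) with Decision.smallRefutation? m ps ψ
... | yes found   = no  (Decision.small→¬admissible m ps ψ found)
... | no  nothing = yes (Decision.¬small→admissible m ps ψ nothing)
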